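{- Let $\mathbf{D}=(\mathbf{d},T)\in\mathbb{N}^n\times\mathbb{N}_{>0}$ with $M=\sum_i d_i$ even, and let $G$ be the temporal multigraph output by the temporal configuration model on input $\mathbf{D}$. Then $G$ is uniformly distributed in the set $\mathcal{S}(\mathbf{W}(G))\subseteq\mathcal{M}(\mathbf{D})$; that is, for any two temporal multigraphs $G_1,G_2\in\mathcal{M}(\mathbf{D})$ with $\mathbf{W}(G_1)=\mathbf{W}(G_2)$, the model outputs $G_1$ and $G_2$ with equal probability.
   Context: A temporal multigraph on nodes $V=\{v_1,\dots,v_n\}$ is a multiset of edges $(\{v_i,v_j\},t)$ with $t\in\mathbb{N}_{>0}$ ($i=j$ allowed, giving a loop). It matches $\mathbf{D}=(\mathbf{d},T)$ if all timestamps lie in $[1,T]$ and each $v_i$ has degree $d_i$ (summed over all timestamps, a loop contributing $2$). $\mathcal{M}(\mathbf{D})$ is the set of temporal multigraphs matching $\mathbf{D}$. Temporal configuration model: put $d_i$ marbles labeled $i$ into an urn for each $i$; starting from the empty graph on $V$, repeat until the urn is empty: draw two marbles uniformly at random without replacement, with labels $i,j$; draw $t$ uniformly at random from $[1,T]$; add the edge $(\{v_i,v_j\},t)$. For nodes $v_i,v_j$ and timestamp $t$, $w_{i,j,t}$ is the number of edges between $v_i$ and $v_j$ with timestamp $t$ (for $i=j$ write $w_{i,t}$ for the number of loops at $v_i$ with timestamp $t$). $\mathbf{W}(G)$ is the $n\times n\times T$ tensor with $\mathbf{W}_{i,j,t}(G)=w_{i,j,t}$ if $i\neq j$ and $w_{i,j,t}\ge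 2$, $\mathbf{W}_{i,j,t}(G)=0$ if $i\neq j$ and $w_{i,j,t}\le 1$, and $\mathbf{W}_{i,i,t}(G)=w_{i,t}$. For a tensor $\mathbf{W}$, $\mathcal{S}(\mathbf{W})=\{G\in\mathcal{M}(\mathbf{D}):\mathbf{W}(G)=\mathbf{W}\}$. -}

module Defs where

open import Data.Nat as ℕ using (ℕ; zero; suc; NonZero; _≤_)
open import Data.Nat.Properties using (_≤?_)
import Data.Nat.Properties
import Data.Fin.Properties
open import Data.Bool using (Bool; true; false; if_then_else_; _∧_; _∨_)
open import Data.Fin using (Fin)
open import Data.Fin.Properties using (_≟_)
open import Data.List as List using (List; []; _∷_; [_]; concatMap; allFin; replicate; foldr; length)
open import Data.Vec as Vec using (Vec; removeAt; lookup; fromList)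
open import Data.Product using (_×_; _,_)
open import Data.Integer using (+_)
open import Data.Rational as ℚ using (ℚ; _/_; 1ℚ; 0ℚ)
open import Relation.Nullary using (does)
open import Data.Nat.ListAction using (sum)
open import Relation.Binary.PropositionalEquality using (_≡_)

-- Temporal multigraphs on nodes v_0 … v_{n-1} (Fin n) with timestamps
-- in [1,T]; timestamp t ∈ [1,T] is represented by (t-1) : Fin T.
-- An edge ({v_i,v_j},t) is a triple (i , j , t); the order of i,j is
-- irrelevant (all notions below are symmetric in i,j).
-- A temporal multigraph (a multiset of edges) is represented by a list of
-- edges; two lists represent the same multigraph iff they have the same
-- multiplicities w_{i,j,t} (see SameGraph).

Edge : ℕ → ℕ → Set
Edge n T = Fin n × Fin n × Fin T

TGraph : ℕ → ℕ → Set
TGraph n T = List (Edge n T)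

joins : ∀ {n T} → Fin n → Fin n → Fin T → Edge n T → Bool
joins i j t (a , b , s) =
  does (s ≟ t) ∧ ((does (a ≟ i) ∧ does (b ≟ j)) ∨ (does (a ≟ j) ∧ does (b ≟ i)))

w : ∀ {n T} → TGraph n T → Fin n → Fin n → Fin T → ℕ
w G i j t = length (List.filterᵇ (joins i j t) G)

endpoints : ∀ {n T} → Fin n → Edge n T → ℕ
endpoints i (a , b , _) =
  (if does (a ≟ i) then 1 else 0) ℕ.+ (if does (b ≟ i) then 1 else 0)

degree : ∀ {n T} → TGraph n T → Fin n → ℕ
degree G i = sum (List.map (endpoints i) G)

-- G ∈ 𝓜(D) for D = (d , T)  (timestamps lie in [1,T] by typing)
Matches : ∀ {n T} → (Fin n → ℕ) → TGraph n T → Set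
Matches d G = ∀ i → degree G i ≡ d i

SameGraph : ∀ {n T} → TGraph n T → TGraph n T → Set
SameGraph G H = ∀ i j t → w G i j t ≡ w H i j t

sameGraph? : ∀ {n T} → TGraph n T → TGraph n T → Bool
sameGraph? G H = does (Data.Fin.Properties.all? λ i →
                        Data.Fin.Properties.all? λ j →
                        Data.Fin.Properties.all? λ t →
                        Data.Nat.Properties._≟_ (w G i j t) (w H i j t))

𝐖 : ∀ {n T} → TGraph n T → Fin n → Fin n → Fin T → ℕ
𝐖 G i j t with does (i ≟ j)
... | true  = w G i j t
... | false = if does (2 ≤? w G i j t) then w G i j t else 0

-- Temporal configuration model as an explicit finite probability
-- distribution: a list of (probability , outcome) pairs, one per
-- execution path of the random process.

-- Each step draws a
-- first marble uniformly among the m marbles, then a second one uniformly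
-- among the remaining m-1 (without replacement), then t uniformly in [1,T],
-- and adds the edge.  (An urn with a single marble cannot occur when
-- M is even; it yields no outcomes.)
run : ∀ {n T} .{{_ : NonZero T}} (m : ℕ) → Vec (Fin n) m → List (ℚ × TGraph n T)
run zero _ = [ (1ℚ , []) ]
run (suc zero) _ = []
run {n} {T} (suc (suc m)) u =
  concatMap (λ p → let u′ = removeAt u p in
  concatMap (λ q → let u″ = removeAt u′ q in
  concatMap (λ t →
    List.map (λ { (π , G) →
        ( ((+ 1 / suc (suc m)) ℚ.* (+ 1 / suc m) ℚ.* (+ 1 / T)) ℚ.* π
        , (lookup u p , lookup u′ q , t) ∷ G) })
      (run m u″))
    (allFin T))
    (allFin (suc m)))
    (allFin (suc (suc m)))

urn : ∀ {n} → (Fin n → ℕ) → List (Fin n)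
urn {n} d = concatMap (λ i → replicate (d i) i) (allFin n)

configModel : ∀ {n} (d : Fin n → ℕ) (T : ℕ) .{{_ : NonZero T}} → List (ℚ × TGraph n T)
configModel d T = run (length (urn d)) (fromList (urn d))

Pr : ∀ {n} (d : Fin n → ℕ) (T : ℕ) .{{_ : NonZero T}} → TGraph n T → ℚ
Pr d T G = foldr (λ { (π , H) acc → (if sameGraph? H G then π else 0ℚ) ℚ.+ acc })
                 0ℚ (configModel d T)

total : ∀ {n} → (Fin n → ℕ) → ℕ
total {n} d = sum (List.map d (allFin n))

-- Every run of the model has the same probability, so Pr G is proportional to the
-- number of runs whose output has the multiplicities w G.  For a symmetric tensor f whose degrees
-- are the label counts of an urn u of even size m,
--   #runs(u, f) · ∏_{i,t} 2^{f i i t} (f i i t)! · ∏_{i<j,t} (f i j t)!  =  m‼ · ∏_i (count u i)!,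
-- by induction over the draws: removing the drawn edge e = {a, b} at time t divides the weight by
-- the number of half-edges at a of the edges {a, b} at time t, removing the two marbles divides
-- ∏_i (count u i)! by their counts, and summed over the second marble and the timestamp the
-- half-edge numbers add up to deg a = count u a.  As 0! = 1! = 1, the weight only depends on
-- 𝐖 G, hence so does the number of runs.

module Submission where

open import Defs
open import Data.Nat using (ℕ; NonZero; _%_)
open import Data.Fin using (Fin)
open import Relation.Binary.PropositionalEquality using (_≡_)

open import Data.Nat hiding (_/_)
import Data.Nat as ℕ
open import Data.Nat.Properties
open import Data.Nat.DivMod using (m≡m%n+[m/n]*n)
open import Data.Nat.ListAction using (sum)
open import Data.Nat.Solver using (module +-*-Solver)
open import Data.Bool using (Bool; true; false; if_then_else_; _∧_; _∨_)
open import Data.Bool.Properties using (∧-zeroʳ; ∧-identityʳ; ∨-identityʳ)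
open import Data.Fin as Fin using (Fin; zero; suc)
import Data.Fin.Properties as Finₚ
open import Data.Product as Product using (_×_; _,_; proj₁; proj₂)
open import Data.Sum as Sum using (_⊎_; inj₁; inj₂)
open import Data.List as List using (List; []; _∷_; _++_; concatMap; tabulate; allFin; replicate)
open import Data.List.Properties using (map-tabulate; length-++; length-replicate; map-cong)
open import Data.List.Relation.Unary.All as All using (All; []; _∷_)
open import Data.List.Relation.Unary.All.Properties using (concat⁺; map⁺; tabulate⁺)
open import Data.Vec as Vec using (Vec; []; _∷_; lookup; removeAt; fromList)
open import Data.Vec.Functional as Vector using (Vector)
open import Data.Integer using (1ℤ)
open import Data.Rational as ℚ using (ℚ; 0ℚ; 1ℚ; _/_)
import Data.Rational.Properties as ℚₚ
open import Algebra.Definitions.RawMonoid ℚ.+-0-rawMonoid using () renaming (_×_ to _×ℚ_)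
import Algebra.Properties.CommutativeSemigroup as CommutativeSemigroupProperties
import Algebra.Properties.Semiring.Sum as SemiringSum
import Algebra.Properties.CommutativeMonoid.Sum as CommutativeMonoidSum
open import Relation.Nullary using (Dec; does; yes; no; ¬_; contradiction)
open import Relation.Nullary.Decidable using (dec-true; dec-false; does-⇔; _×-dec_; _⊎-dec_)
open import Relation.Binary using (tri<; tri≈; tri>)
open import Relation.Binary.PropositionalEquality
open import Function using (_∘_; id; _⇔_; mk⇔)

module +-CS = CommutativeSemigroupProperties +-commutativeSemigroup
module *-CS = CommutativeSemigroupProperties *-commutativeSemigroup
module ∑ = SemiringSum +-*-semiring
module ∏ = CommutativeMonoidSum *-1-commutativeMonoid

open ∑ using (∑-distrib-+; *-distribˡ-sum; *-distribʳ-sum) renaming (sum to ∑)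

private variable n m T : ℕ

-- Finite sums and products

∏ : ∀ {k} → Vector ℕ k → ℕ
∏ = ∏.sum

∑-cong : ∀ {k} {f g : Vector ℕ k} → (∀ x → f x ≡ g x) → ∑ f ≡ ∑ g
∑-cong = ∑.sum-cong-≗

∑-const : ∀ k c → ∑ {k} (λ _ → c) ≡ k * c
∑-const zero    c = refl
∑-const (suc k) c = cong (c +_) (∑-const k c)

∑-zero : ∀ k → ∑ {k} (λ _ → 0) ≡ 0
∑-zero k = ∑.sum-replicate-zero k

∑-supported : ∀ {k} (f : Vector ℕ k) x → (∀ y → y ≢ x → f y ≡ 0) → ∑ f ≡ f x
∑-supported {suc k} f x off = begin
  ∑ f                            ≡⟨ ∑.sum-remove {i = x} f ⟩
  f x + ∑ (Vector.removeAt f x)  ≡⟨ cong (f x +_) (∑-cong (λ y → off _ (Finₚ.punchInᵢ≢i x y))) ⟩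
  f x + ∑ {k} (λ _ → 0)          ≡⟨ cong (f x +_) (∑-zero k) ⟩
  f x + 0                        ≡⟨ +-identityʳ (f x) ⟩
  f x                            ∎
  where open ≡-Reasoning

≤-∑ : ∀ {k} (f : Vector ℕ k) x → f x ≤ ∑ f
≤-∑ f zero    = m≤m+n _ _
≤-∑ f (suc x) = ≤-trans (≤-∑ (f ∘ suc) x) (m≤n+m _ _)

∏-cong : ∀ {k} {f g : Vector ℕ k} → (∀ x → f x ≡ g x) → ∏ f ≡ ∏ g
∏-cong = ∏.sum-cong-≗

∏-one : ∀ k → ∏ {k} (λ _ → 1) ≡ 1
∏-one k = ∏.sum-replicate-zero k

∏-update : ∀ {k} (f g : Vector ℕ k) x r → (∀ y → y ≢ x → f y ≡ g y) → f x ≡ g x * r →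
           ∏ f ≡ ∏ g * r
∏-update {suc k} f g x r same fx≡ = begin
  ∏ f                                ≡⟨ ∏.sum-remove {i = x} f ⟩
  f x * ∏ (Vector.removeAt f x)      ≡⟨ cong₂ _*_ fx≡ (∏-cong (λ y → same _ (Finₚ.punchInᵢ≢i x y))) ⟩
  g x * r * ∏ (Vector.removeAt g x)  ≡⟨ *-CS.xy∙z≈xz∙y (g x) r _ ⟩
  g x * ∏ (Vector.removeAt g x) * r  ≡⟨ cong (_* r) (∏.sum-remove {i = x} g) ⟨
  ∏ g * r                            ∎
  where open ≡-Reasoning

∏-positive : ∀ {k} (f : Vector ℕ k) → (∀ x → 1 ≤ f x) → 1 ≤ ∏ f
∏-positive {zero}  f pos = ≤-refl
∏-positive {suc k} f pos = *-mono-≤ (pos zero) (∏-positive (f ∘ suc) (pos ∘ suc))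

∏³-update : ∀ (F G : Fin n → Fin n → Fin T → ℕ) a b s r →
  (∀ i j t → (i , j , t) ≢ (a , b , s) → F i j t ≡ G i j t) → F a b s ≡ G a b s * r →
  (∏ λ i → ∏ λ j → ∏ λ t → F i j t) ≡ (∏ λ i → ∏ λ j → ∏ λ t → G i j t) * r
∏³-update {n} {T} F G a b s r off at =
  ∏-update _ _ a r (λ i i≢a → ∏-cong {n} λ j → ∏-cong {T} λ t → off i j t (i≢a ∘ cong proj₁))
    (∏-update _ _ b r (λ j j≢b → ∏-cong {T} λ t → off a j t (j≢b ∘ cong (proj₁ ∘ proj₂)))
      (∏-update _ _ s r (λ t t≢s → off a b t (t≢s ∘ cong (proj₂ ∘ proj₂))) at))

sum-tabulate : ∀ {k} (h : Fin k → ℕ) → sum (tabulate h) ≡ ∑ h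
sum-tabulate {zero}  h = refl
sum-tabulate {suc k} h = cong (h zero +_) (sum-tabulate (h ∘ suc))

sum-map-allFin : ∀ {k} (h : Fin k → ℕ) → sum (List.map h (allFin k)) ≡ ∑ h
sum-map-allFin h = trans (cong sum (map-tabulate id h)) (sum-tabulate h)

-- Multiplicity tensors

Tensor : ℕ → ℕ → Set
Tensor n T = Fin n → Fin n → Fin T → ℕ

Symmetric : Tensor n T → Set
Symmetric f = ∀ i j t → f i j t ≡ f j i t

infix 4 _≐_ _≐?_ _≤ᵗ_ _≤ᵗ?_
infixl 6 _⊖_

_≐_ : Tensor n T → Tensor n T → Set
f ≐ g = ∀ i j t → f i j t ≡ g i j t

_≐?_ : (f g : Tensor n T) → Dec (f ≐ g)
f ≐? g = Finₚ.all? λ i → Finₚ.all? λ j → Finₚ.all? λ t → f i j t ≟ g i j t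

_≤ᵗ_ : Tensor n T → Tensor n T → Set
f ≤ᵗ g = ∀ i j t → f i j t ≤ g i j t

_≤ᵗ?_ : (f g : Tensor n T) → Dec (f ≤ᵗ g)
f ≤ᵗ? g = Finₚ.all? λ i → Finₚ.all? λ j → Finₚ.all? λ t → f i j t ≤? g i j t

𝟙 : Bool → ℕ
𝟙 b = if b then 1 else 0

δ : Fin n → Fin n → ℕ
δ a b = 𝟙 (does (a Finₚ.≟ b))

δ-refl : ∀ (a : Fin n) → δ a a ≡ 1
δ-refl a = cong 𝟙 (dec-true (a Finₚ.≟ a) refl)

δ-≢ : ∀ {a b : Fin n} → a ≢ b → δ a b ≡ 0
δ-≢ {a = a} {b} a≢b = cong 𝟙 (dec-false (a Finₚ.≟ b) a≢b)

∑-δ : ∀ (a : Fin n) → ∑ (δ a) ≡ 1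
∑-δ a = trans (∑-supported (δ a) a λ j j≢a → δ-≢ (j≢a ∘ sym)) (δ-refl a)

edge : Edge n T → Tensor n T
edge e i j t = 𝟙 (joins i j t e)

Joins : Fin n → Fin n → Fin T → Edge n T → Set
Joins i j t (a , b , s) = s ≡ t × ((a ≡ i × b ≡ j) ⊎ (a ≡ j × b ≡ i))

-- does (joins? i j t e) is definitionally joins i j t e.
joins? : ∀ i j t (e : Edge n T) → Dec (Joins i j t e)
joins? i j t (a , b , s) =
  s Finₚ.≟ t ×-dec ((a Finₚ.≟ i ×-dec b Finₚ.≟ j) ⊎-dec (a Finₚ.≟ j ×-dec b Finₚ.≟ i))

edge-⊎ : ∀ (e : Edge n T) i j t → edge e i j t ≡ 0 ⊎ Joins i j t e
edge-⊎ (a , b , s) i j t = by-cases (joins? i j t (a , b , s)) refl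
  where
  by-cases : (d : Dec (Joins i j t (a , b , s))) → edge (a , b , s) i j t ≡ 𝟙 (does d) →
             edge (a , b , s) i j t ≡ 0 ⊎ Joins i j t (a , b , s)
  by-cases (yes J) _  = inj₂ J
  by-cases (no _)  e≡ = inj₁ e≡

edge-at : ∀ (a b : Fin n) (s : Fin T) → edge (a , b , s) a b s ≡ 1
edge-at a b s = cong 𝟙 (dec-true (joins? a b s (a , b , s)) (refl , inj₁ (refl , refl)))

edge-≤1 : ∀ (e : Edge n T) i j t → edge e i j t ≤ 1
edge-≤1 e i j t with joins i j t e
... | true  = ≤-refl
... | false = z≤n

edge-symmetric : (e : Edge n T) → Symmetric (edge e)
edge-symmetric (a , b , s) i j t =
  cong 𝟙 (does-⇔ (mk⇔ (Product.map₂ Sum.swap) (Product.map₂ Sum.swap))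
                 (joins? i j t (a , b , s)) (joins? j i t (a , b , s)))

edge-flip : ∀ {n T} (a b : Fin n) (s : Fin T) i j t → edge (a , b , s) i j t ≡ edge (b , a , s) i j t
edge-flip {n} a b s i j t =
  cong 𝟙 (does-⇔ (mk⇔ flip flip) (joins? i j t (a , b , s)) (joins? i j t (b , a , s)))
  where
  flip : ∀ {a b : Fin n} → Joins i j t (a , b , s) → Joins i j t (b , a , s)
  flip = Product.map₂ (Sum.swap ∘ Sum.map Product.swap Product.swap)

_⊖_ : Tensor n T → Edge n T → Tensor n T
(f ⊖ e) i j t = f i j t ∸ edge e i j t

⊖-symmetric : {f : Tensor n T} → Symmetric f → ∀ e → Symmetric (f ⊖ e)
⊖-symmetric f-sym e i j t = cong₂ _∸_ (f-sym i j t) (edge-symmetric e i j t)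

edge-≤ᵗ : (f : Tensor n T) → Symmetric f → ∀ a b s → 1 ≤ f a b s → edge (a , b , s) ≤ᵗ f
edge-≤ᵗ f f-sym a b s pos i j t with edge-⊎ (a , b , s) i j t
... | inj₁ e≡0 = subst (_≤ f i j t) (sym e≡0) z≤n
... | inj₂ (refl , inj₁ (refl , refl)) = ≤-trans (edge-≤1 (a , b , s) a b t) pos
... | inj₂ (refl , inj₂ (refl , refl)) = ≤-trans (edge-≤1 (a , b , s) b a t) (subst (1 ≤_) (f-sym a b t) pos)

w-∷ : ∀ (e : Edge n T) G i j t → w (e ∷ G) i j t ≡ edge e i j t + w G i j t
w-∷ e G i j t with joins i j t e
... | true  = refl
... | false = refl

w-symmetric : (G : TGraph n T) → Symmetric (w G)
w-symmetric []      i j t = refl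
w-symmetric (e ∷ G) i j t = begin
  w (e ∷ G) i j t           ≡⟨ w-∷ e G i j t ⟩
  edge e i j t + w G i j t  ≡⟨ cong₂ _+_ (edge-symmetric e i j t) (w-symmetric G i j t) ⟩
  edge e j i t + w G j i t  ≡⟨ w-∷ e G j i t ⟨
  w (e ∷ G) j i t           ∎
  where open ≡-Reasoning

-- Degrees

-- A loop at i contributes twice: once in the first sum (j = i) and once in the second.
deg : Tensor n T → Fin n → ℕ
deg f i = ∑ (λ j → ∑ (f i j)) + ∑ (f i i)

deg-cong : {f g : Tensor n T} → f ≐ g → ∀ i → deg f i ≡ deg g i
deg-cong f≐g i = cong₂ _+_ (∑-cong λ j → ∑-cong (f≐g i j)) (∑-cong (f≐g i i))

deg-+ : (f g : Tensor n T) → ∀ i → deg (λ i j t → f i j t + g i j t) i ≡ deg f i + deg g i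
deg-+ f g i = begin
  ∑ (λ j → ∑ (λ t → f i j t + g i j t)) + ∑ (λ t → f i i t + g i i t)
    ≡⟨ cong₂ _+_ (trans (∑-cong λ j → ∑-distrib-+ (f i j) (g i j))
                        (∑-distrib-+ (λ j → ∑ (f i j)) (λ j → ∑ (g i j))))
                 (∑-distrib-+ (f i i) (g i i)) ⟩
  ∑ (λ j → ∑ (f i j)) + ∑ (λ j → ∑ (g i j)) + (∑ (f i i) + ∑ (g i i))
    ≡⟨ +-CS.interchange (∑ (λ j → ∑ (f i j))) (∑ (λ j → ∑ (g i j))) (∑ (f i i)) (∑ (g i i)) ⟩
  deg f i + deg g i
    ∎
  where open ≡-Reasoning

∑-at-timestamp : ∀ (s : Fin T) b → ∑ (λ t → 𝟙 (does (s Finₚ.≟ t) ∧ b)) ≡ 𝟙 b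
∑-at-timestamp s b =
  trans (∑-supported _ s λ t t≢s → cong (λ x → 𝟙 (x ∧ b)) (dec-false (s Finₚ.≟ t) (t≢s ∘ sym)))
        (cong (λ x → 𝟙 (x ∧ b)) (dec-true (s Finₚ.≟ s) refl))

deg-edge : ∀ (e : Edge n T) i → deg (edge e) i ≡ endpoints i e
deg-edge {n} (a , b , s) i = begin
  deg (edge (a , b , s)) i
    ≡⟨ cong₂ _+_ (∑-cong λ j → ∑-at-timestamp s (links j)) (∑-at-timestamp s (links i)) ⟩
  ∑ (λ j → 𝟙 (links j)) + 𝟙 (links i)
    ≡⟨ by-endpoints (a Finₚ.≟ i) (b Finₚ.≟ i) ⟩
  endpoints i (a , b , s)
    ∎
  where
  open ≡-Reasoning
  links : Fin n → Bool
  links j = (does (a Finₚ.≟ i) ∧ does (b Finₚ.≟ j)) ∨ (does (a Finₚ.≟ j) ∧ does (b Finₚ.≟ i))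
  by-endpoints : (a≟i : Dec (a ≡ i)) (b≟i : Dec (b ≡ i)) →
    ∑ (λ j → 𝟙 ((does a≟i ∧ does (b Finₚ.≟ j)) ∨ (does (a Finₚ.≟ j) ∧ does b≟i)))
      + 𝟙 ((does a≟i ∧ does b≟i) ∨ (does a≟i ∧ does b≟i))
    ≡ 𝟙 (does a≟i) + 𝟙 (does b≟i)
  by-endpoints (yes refl) (yes refl) = cong (_+ 1) (trans (∑-cong loop) (∑-δ a))
    where
    loop : ∀ j → 𝟙 (does (a Finₚ.≟ j) ∨ (does (a Finₚ.≟ j) ∧ true)) ≡ δ a j
    loop j with does (a Finₚ.≟ j)
    ... | true  = refl
    ... | false = refl
  by-endpoints (yes _) (no _) = cong (_+ 0) (trans (∑-cong λ j →
    cong 𝟙 (trans (cong (does (b Finₚ.≟ j) ∨_) (∧-zeroʳ (does (a Finₚ.≟ j)))) (∨-identityʳ _)))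
    (∑-δ b))
  by-endpoints (no _) (yes _) =
    cong (_+ 0) (trans (∑-cong λ j → cong 𝟙 (∧-identityʳ (does (a Finₚ.≟ j)))) (∑-δ a))
  by-endpoints (no _) (no _) =
    cong (_+ 0) (trans (∑-cong λ j → cong 𝟙 (∧-zeroʳ (does (a Finₚ.≟ j)))) (∑-zero n))

deg-w : ∀ (G : TGraph n T) i → deg (w G) i ≡ degree G i
deg-w {n} {T} [] i =
  trans (cong (_+ ∑ {T} (λ _ → 0)) (trans (∑-cong {n} λ j → ∑-zero T) (∑-zero n))) (∑-zero T)
deg-w (e ∷ G) i = begin
  deg (w (e ∷ G)) i                             ≡⟨ deg-cong (w-∷ e G) i ⟩
  deg (λ i j t → edge e i j t + w G i j t) i    ≡⟨ deg-+ (edge e) (w G) i ⟩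
  deg (edge e) i + deg (w G) i                  ≡⟨ cong₂ _+_ (deg-edge e i) (deg-w G i) ⟩
  degree (e ∷ G) i                              ∎
  where open ≡-Reasoning

deg-⊖ : ∀ (f : Tensor n T) e → edge e ≤ᵗ f → ∀ i → deg (f ⊖ e) i ≡ deg f i ∸ endpoints i e
deg-⊖ f e e≤f i = begin
  deg (f ⊖ e) i                                     ≡⟨ m+n∸n≡m (deg (f ⊖ e) i) (deg (edge e) i) ⟨
  deg (f ⊖ e) i + deg (edge e) i ∸ deg (edge e) i   ≡⟨ cong₂ _∸_ restore (deg-edge e i) ⟩
  deg f i ∸ endpoints i e                           ∎
  where
  open ≡-Reasoning
  restore : deg (f ⊖ e) i + deg (edge e) i ≡ deg f i
  restore = trans (sym (deg-+ (f ⊖ e) (edge e) i)) (deg-cong (λ i j t → m∸n+n≡m (e≤f i j t)) i)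

≤-deg : ∀ (f : Tensor n T) i j t → f i j t ≤ deg f i
≤-deg f i j t = ≤-trans (≤-∑ (f i j) t) (≤-trans (≤-∑ (λ j → ∑ (f i j)) j) (m≤m+n _ _))

loops-≤-deg : ∀ (f : Tensor n T) i t → f i i t + f i i t ≤ deg f i
loops-≤-deg f i t = +-mono-≤ (≤-trans (≤-∑ (f i i) t) (≤-∑ (λ j → ∑ (f i j)) i)) (≤-∑ (f i i) t)

-- Counting the runs of the model

#matching : List (ℚ × TGraph n T) → Tensor n T → ℕ
#matching []            f = 0
#matching ((_ , G) ∷ L) f = 𝟙 (does (w G ≐? f)) + #matching L f

#matching-++ : ∀ (L M : List (ℚ × TGraph n T)) f → #matching (L ++ M) f ≡ #matching L f + #matching M f
#matching-++ []      M f = refl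
#matching-++ ((_ , G) ∷ L) M f =
  trans (cong (_ +_) (#matching-++ L M f)) (sym (+-assoc (𝟙 (does (w G ≐? f))) (#matching L f) _))

#matching-concatMap : ∀ {A : Set} (g : A → List (ℚ × TGraph n T)) xs f →
  #matching (concatMap g xs) f ≡ sum (List.map (λ x → #matching (g x) f) xs)
#matching-concatMap g []       f = refl
#matching-concatMap g (x ∷ xs) f =
  trans (#matching-++ (g x) (concatMap g xs) f) (cong (_ +_) (#matching-concatMap g xs f))

#matching-concatMap-allFin : ∀ k (g : Fin k → List (ℚ × TGraph n T)) f →
  #matching (concatMap g (allFin k)) f ≡ ∑ (λ x → #matching (g x) f)
#matching-concatMap-allFin k g f =
  trans (#matching-concatMap g (allFin k) f) (sum-map-allFin (λ x → #matching (g x) f))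

≐-∷⇒≤ᵗ : ∀ (e : Edge n T) G f → w (e ∷ G) ≐ f → edge e ≤ᵗ f
≐-∷⇒≤ᵗ e G f eq i j t = subst (edge e i j t ≤_) (trans (sym (w-∷ e G i j t)) (eq i j t)) (m≤m+n _ _)

≐-∷⇔ : ∀ (e : Edge n T) G f → edge e ≤ᵗ f → w (e ∷ G) ≐ f ⇔ w G ≐ f ⊖ e
≐-∷⇔ e G f e≤f = mk⇔
  (λ eq i j t → begin
    w G i j t                           ≡⟨ m+n∸m≡n (edge e i j t) _ ⟨
    edge e i j t + w G i j t ∸ edge e i j t ≡⟨ cong (_∸ edge e i j t) (trans (sym (w-∷ e G i j t)) (eq i j t)) ⟩
    (f ⊖ e) i j t                        ∎)
  (λ eq i j t → begin
    w (e ∷ G) i j t                     ≡⟨ w-∷ e G i j t ⟩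
    edge e i j t + w G i j t            ≡⟨ cong (edge e i j t +_) (eq i j t) ⟩
    edge e i j t + (f i j t ∸ edge e i j t) ≡⟨ m+[n∸m]≡n (e≤f i j t) ⟩
    f i j t                             ∎)
  where open ≡-Reasoning

#matching-prepend : ∀ (e : Edge n T) (h : ℚ × TGraph n T → ℚ × TGraph n T) →
  (∀ x → proj₂ (h x) ≡ e ∷ proj₂ x) → ∀ L f →
  #matching (List.map h L) f ≡ (if does (edge e ≤ᵗ? f) then #matching L (f ⊖ e) else 0)
#matching-prepend e h prepends L f = by-cases (edge e ≤ᵗ? f)
  where
  by-cases : (e≤f? : Dec (edge e ≤ᵗ f)) →
             #matching (List.map h L) f ≡ (if does e≤f? then #matching L (f ⊖ e) else 0)
  by-cases (yes e≤f) = go L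
    where
    go : ∀ L → #matching (List.map h L) f ≡ #matching L (f ⊖ e)
    go []      = refl
    go (x ∷ L) = cong₂ _+_
      (cong 𝟙 (trans (cong (λ G → does (w G ≐? f)) (prepends x))
                     (does-⇔ (≐-∷⇔ e (proj₂ x) f e≤f) (w (e ∷ proj₂ x) ≐? f) (w (proj₂ x) ≐? f ⊖ e))))
      (go L)
  by-cases (no e≰f) = go L
    where
    go : ∀ L → #matching (List.map h L) f ≡ 0
    go []      = refl
    go (x ∷ L) = cong₂ _+_
      (cong 𝟙 (trans (cong (λ G → does (w G ≐? f)) (prepends x))
                     (dec-false (w (e ∷ proj₂ x) ≐? f) (e≰f ∘ ≐-∷⇒≤ᵗ e (proj₂ x) f))))
      (go L)

#runs : ∀ .{{_ : NonZero T}} m → Vec (Fin n) m → Tensor n T → ℕ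
#runs m u f = #matching (run m u) f

drawnEdge : ∀ {m} → Vec (Fin n) (2 + m) → Fin (2 + m) → Fin (1 + m) → Fin T → Edge n T
drawnEdge u p q t = lookup u p , lookup (removeAt u p) q , t

leftover : ∀ {m} → Vec (Fin n) (2 + m) → Fin (2 + m) → Fin (1 + m) → Vec (Fin n) m
leftover u p q = removeAt (removeAt u p) q

drawProbability : ∀ T .{{_ : NonZero T}} → ℕ → ℚ
drawProbability T m = (1ℤ / suc (suc m)) ℚ.* (1ℤ / suc m) ℚ.* (1ℤ / T)

#runsAfterDraw : ∀ .{{_ : NonZero T}} m → Vec (Fin n) (2 + m) → Tensor n T →
  Fin (2 + m) → Fin (1 + m) → Fin T → ℕ
#runsAfterDraw m u f p q t = if does (edge (drawnEdge u p q t) ≤ᵗ? f)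
                             then #runs m (leftover u p q) (f ⊖ drawnEdge u p q t) else 0

#runs-step : ∀ {n T} .{{_ : NonZero T}} m (u : Vec (Fin n) (2 + m)) (f : Tensor n T) →
  #runs (2 + m) u f ≡ ∑ λ p → ∑ λ q → ∑ λ t → #runsAfterDraw m u f p q t
#runs-step {n} {T} m u f =
  trans (#matching-concatMap-allFin (2 + m) (λ p → concatMap (branches p) (allFin (1 + m))) f)
        (∑-cong {2 + m} λ p →
  trans (#matching-concatMap-allFin (1 + m) (branches p) f) (∑-cong {1 + m} λ q →
  trans (#matching-concatMap-allFin T (branch p q) f) (∑-cong {T} λ t →
  #matching-prepend (drawnEdge u p q t) _ (λ _ → refl) (run m (leftover u p q)) f)))
  where
  branch : ∀ p q t → List (ℚ × TGraph n T)
  branch p q t = List.map (λ x → drawProbability T m ℚ.* proj₁ x , drawnEdge u p q t ∷ proj₂ x)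
                          (run m (leftover u p q))
  branches : ∀ p q → List (ℚ × TGraph n T)
  branches p q = concatMap (branch p q) (allFin T)

All-concatMap-allFin : ∀ {A : Set} {P : A → Set} k (g : Fin k → List A) →
  (∀ x → All P (g x)) → All P (concatMap g (allFin k))
All-concatMap-allFin k g Pg = concat⁺ (map⁺ (tabulate⁺ Pg))

-- The value at 1 is arbitrary: run 1 u has no outcomes.
pathProbability : ∀ T .{{_ : NonZero T}} → ℕ → ℚ
pathProbability T zero          = 1ℚ
pathProbability T (suc zero)    = 0ℚ
pathProbability T (suc (suc m)) = drawProbability T m ℚ.* pathProbability T m

run-uniform : ∀ .{{_ : NonZero T}} m (u : Vec (Fin n) m) →
  All (λ x → proj₁ x ≡ pathProbability T m) (run m u)
run-uniform zero          u = refl ∷ []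
run-uniform (suc zero)    u = []
run-uniform {T = T} (suc (suc m)) u =
  All-concatMap-allFin (2 + m) _ λ p → All-concatMap-allFin (1 + m) _ λ q → All-concatMap-allFin T _ λ t →
    map⁺ (All.map (cong (drawProbability T m ℚ.*_)) (run-uniform m (leftover u p q)))

Pr≡#runs×pathProbability : ∀ (d : Fin n → ℕ) T .{{_ : NonZero T}} (G : TGraph n T) →
  let M = List.length (urn d) in
  Pr d T G ≡ #runs M (fromList (urn d)) (w G) ×ℚ pathProbability T M
Pr≡#runs×pathProbability d T G = go (configModel d T) (run-uniform _ (fromList (urn d)))
  where
  -- sameGraph? H G is definitionally does (w H ≐? w G).
  go : ∀ L → All (λ x → proj₁ x ≡ pathProbability T (List.length (urn d))) L →
       List.foldr (λ { (π , H) acc → (if sameGraph? H G then π else 0ℚ) ℚ.+ acc }) 0ℚ L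
       ≡ #matching L (w G) ×ℚ pathProbability T (List.length (urn d))
  go []            []          = refl
  go ((π , H) ∷ L) (π≡ ∷ L≡) = add-outcome (does (w H ≐? w G)) π≡ (go L L≡)
    where
    add-outcome : ∀ b {π x P k} → π ≡ P → x ≡ k ×ℚ P → (if b then π else 0ℚ) ℚ.+ x ≡ (𝟙 b + k) ×ℚ P
    add-outcome true  π≡ x≡ = cong₂ ℚ._+_ π≡ x≡
    add-outcome false π≡ x≡ = trans (ℚₚ.+-identityˡ _) x≡

-- Urns

count : Vec (Fin n) m → Fin n → ℕ
count []      b = 0
count (x ∷ v) b = δ x b + count v b

count-lookup-≥ : ∀ (v : Vec (Fin n) m) p b → δ (lookup v p) b ≤ count v b
count-lookup-≥ (x ∷ v) zero    b = m≤m+n _ _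
count-lookup-≥ (x ∷ v) (suc p) b = ≤-trans (count-lookup-≥ v p b) (m≤n+m _ _)

count-lookup : ∀ (v : Vec (Fin n) m) p → 1 ≤ count v (lookup v p)
count-lookup v p = subst (_≤ count v (lookup v p)) (δ-refl (lookup v p)) (count-lookup-≥ v p (lookup v p))

count-removeAt : ∀ (v : Vec (Fin n) (suc m)) p b →
  count (removeAt v p) b ≡ count v b ∸ δ (lookup v p) b
count-removeAt (x ∷ v)     zero    b = sym (m+n∸m≡n (δ x b) (count v b))
count-removeAt (x ∷ y ∷ v) (suc p) b =
  trans (cong (δ x b +_) (count-removeAt (y ∷ v) p b))
        (sym (+-∸-assoc (δ x b) (count-lookup-≥ (y ∷ v) p b)))

count-leftover : ∀ {T} (u : Vec (Fin n) (2 + m)) p q (t : Fin T) i →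
  count (leftover u p q) i ≡ count u i ∸ endpoints i (drawnEdge u p q t)
count-leftover u p q t i = begin
  count (removeAt (removeAt u p) q) i
    ≡⟨ count-removeAt (removeAt u p) q i ⟩
  count (removeAt u p) i ∸ δ (lookup (removeAt u p) q) i
    ≡⟨ cong (_∸ δ (lookup (removeAt u p) q) i) (count-removeAt u p i) ⟩
  count u i ∸ δ (lookup u p) i ∸ δ (lookup (removeAt u p) q) i
    ≡⟨ ∸-+-assoc (count u i) (δ (lookup u p) i) (δ (lookup (removeAt u p) q) i) ⟩
  count u i ∸ endpoints i (drawnEdge u p q t)
    ∎
  where open ≡-Reasoning

∑-lookup : ∀ (v : Vec (Fin n) m) (g : Fin n → ℕ) → ∑ (λ q → g (lookup v q)) ≡ ∑ (λ b → count v b * g b)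
∑-lookup {n} []      g = sym (∑-zero n)
∑-lookup {n} (x ∷ v) g = sym (begin
  ∑ (λ b → (δ x b + count v b) * g b)
    ≡⟨ ∑-cong {n} (λ b → *-distribʳ-+ (g b) (δ x b) (count v b)) ⟩
  ∑ (λ b → δ x b * g b + count v b * g b)
    ≡⟨ ∑.∑-distrib-+ (λ b → δ x b * g b) (λ b → count v b * g b) ⟩
  ∑ (λ b → δ x b * g b) + ∑ (λ b → count v b * g b)
    ≡⟨ cong₂ _+_ at-x (∑-lookup v g) ⟨
  g x + ∑ (λ q → g (lookup v q))
    ∎)
  where
  open ≡-Reasoning
  at-x : g x ≡ ∑ (λ b → δ x b * g b)
  at-x = sym (trans (∑-supported _ x λ b b≢x → cong (_* g b) (δ-≢ (b≢x ∘ sym)))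
                    (trans (cong (_* g x) (δ-refl x)) (+-identityʳ (g x))))

count-fromList-++ : ∀ (xs ys : List (Fin n)) b →
  count (fromList (xs ++ ys)) b ≡ count (fromList xs) b + count (fromList ys) b
count-fromList-++ []       ys b = refl
count-fromList-++ (x ∷ xs) ys b =
  trans (cong (δ x b +_) (count-fromList-++ xs ys b))
        (sym (+-assoc (δ x b) _ _))

count-fromList-replicate : ∀ k (i b : Fin n) → count (fromList (replicate k i)) b ≡ k * δ i b
count-fromList-replicate zero    i b = refl
count-fromList-replicate (suc k) i b = cong (δ i b +_) (count-fromList-replicate k i b)

count-fromList-concatMap : ∀ {A : Set} (g : A → List (Fin n)) xs b →
  count (fromList (concatMap g xs)) b ≡ sum (List.map (λ x → count (fromList (g x)) b) xs)
count-fromList-concatMap g []       b = refl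
count-fromList-concatMap g (x ∷ xs) b =
  trans (count-fromList-++ (g x) (concatMap g xs) b) (cong (_ +_) (count-fromList-concatMap g xs b))

count-urn : ∀ (d : Fin n → ℕ) b → count (fromList (urn d)) b ≡ d b
count-urn {n} d b = begin
  count (fromList (urn d)) b
    ≡⟨ count-fromList-concatMap (λ i → replicate (d i) i) (allFin n) b ⟩
  sum (List.map (λ i → count (fromList (replicate (d i) i)) b) (allFin n))
    ≡⟨ sum-map-allFin (λ i → count (fromList (replicate (d i) i)) b) ⟩
  ∑ (λ i → count (fromList (replicate (d i) i)) b)
    ≡⟨ ∑-cong {n} (λ i → count-fromList-replicate (d i) i b) ⟩
  ∑ (λ i → d i * δ i b)
    ≡⟨ ∑-supported _ b (λ i i≢b → trans (cong (d i *_) (δ-≢ i≢b)) (*-zeroʳ (d i))) ⟩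
  d b * δ b b
    ≡⟨ cong (d b *_) (δ-refl b) ⟩
  d b * 1
    ≡⟨ *-identityʳ (d b) ⟩
  d b
    ∎
  where open ≡-Reasoning

length-concatMap : ∀ {A B : Set} (g : A → List B) xs →
  List.length (concatMap g xs) ≡ sum (List.map (List.length ∘ g) xs)
length-concatMap g []       = refl
length-concatMap g (x ∷ xs) = trans (length-++ (g x)) (cong (_ +_) (length-concatMap g xs))

length-urn : ∀ (d : Fin n → ℕ) → List.length (urn d) ≡ total d
length-urn {n} d = trans (length-concatMap (λ i → replicate (d i) i) (allFin n))
                         (cong sum (map-cong (λ i → length-replicate (d i)) (allFin n)))

factorials : Vec (Fin n) m → ℕ
factorials v = ∏ λ i → count v i !

!-∸1 : ∀ x → 1 ≤ x → x ! ≡ (x ∸ 1) ! * x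
!-∸1 (suc x) _ = *-comm (suc x) (x !)

∏-!-decrement : ∀ (c : Fin n → ℕ) b → 1 ≤ c b →
  (∏ λ i → (c i ∸ δ b i) !) * c b ≡ ∏ λ i → c i !
∏-!-decrement c b 1≤cb = sym (∏-update _ _ b (c b)
  (λ i i≢b → cong (λ x → (c i ∸ x) !) (sym (δ-≢ (i≢b ∘ sym))))
  (trans (!-∸1 (c b) 1≤cb) (cong (λ x → (c b ∸ x) ! * c b) (sym (δ-refl b)))))

factorials-removeAt : ∀ (v : Vec (Fin n) (suc m)) p → factorials (removeAt v p) * count v (lookup v p) ≡ factorials v
factorials-removeAt {n} v p =
  trans (cong (_* count v (lookup v p)) (∏-cong {n} λ i → cong _! (count-removeAt v p i)))
        (∏-!-decrement (count v) (lookup v p) (count-lookup v p))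

∑-removeAt-factorials : ∀ (v : Vec (Fin n) (suc m)) (ρ : Fin n → ℕ) → (∀ b → count v b ≡ 0 → ρ b ≡ 0) →
  ∑ (λ q → factorials (removeAt v q) * ρ (lookup v q)) ≡ factorials v * ∑ ρ
∑-removeAt-factorials {n} {m} v ρ ρ-vanishes = begin
  ∑ (λ q → factorials (removeAt v q) * ρ (lookup v q))
    ≡⟨ ∑-cong {suc m} (λ q → cong (_* ρ (lookup v q)) (∏-cong {n} λ i → cong _! (count-removeAt v q i))) ⟩
  ∑ (λ q → weighted (lookup v q))
    ≡⟨ ∑-lookup v weighted ⟩
  ∑ (λ b → count v b * weighted b)
    ≡⟨ ∑-cong {n} (λ b → per-label (count v b) {removed b} (∏-!-decrement (count v) b) (ρ-vanishes b)) ⟩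
  ∑ (λ b → factorials v * ρ b)
    ≡⟨ *-distribˡ-sum (factorials v) ρ ⟨
  factorials v * ∑ ρ
    ∎
  where
  open ≡-Reasoning
  removed weighted : Fin n → ℕ
  removed b = ∏ λ i → (count v i ∸ δ b i) !
  weighted b = removed b * ρ b
  per-label : ∀ c {P F x} → (1 ≤ c → P * c ≡ F) → (c ≡ 0 → x ≡ 0) → c * (P * x) ≡ F * x
  per-label zero    {F = F} _ x≡0 = sym (trans (cong (F *_) (x≡0 refl)) (*-zeroʳ F))
  per-label (suc c) {P} {x = x} P*c≡F _ =
    trans (*-CS.x∙yz≈yx∙z (suc c) P x) (cong (_* x) (P*c≡F (s≤s z≤n)))

-- Weights

pairWeight : Fin n → Fin n → ℕ → ℕ
pairWeight a b x with Finₚ.<-cmp a b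
... | tri< _ _ _ = x !
... | tri≈ _ _ _ = 2 ^ x * x !
... | tri> _ _ _ = 1

pairWeight-< : ∀ {a b : Fin n} x → a Fin.< b → pairWeight a b x ≡ x !
pairWeight-< {a = a} {b} x a<b with Finₚ.<-cmp a b
... | tri< _ _ _    = refl
... | tri≈ a≮b _ _  = contradiction a<b a≮b
... | tri> a≮b _ _  = contradiction a<b a≮b

pairWeight-≡ : ∀ (a : Fin n) x → pairWeight a a x ≡ 2 ^ x * x !
pairWeight-≡ a x with Finₚ.<-cmp a a
... | tri< _ a≢a _ = contradiction refl a≢a
... | tri≈ _ _ _   = refl
... | tri> _ a≢a _ = contradiction refl a≢a

pairWeight-> : ∀ {a b : Fin n} x → b Fin.< a → pairWeight a b x ≡ 1
pairWeight-> {a = a} {b} x b<a with Finₚ.<-cmp a b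
... | tri< _ _ b≮a = contradiction b<a b≮a
... | tri≈ _ _ b≮a = contradiction b<a b≮a
... | tri> _ _ _   = refl

pairWeight-≢ : ∀ {a b : Fin n} {x y} → a ≢ b → x ! ≡ y ! → pairWeight a b x ≡ pairWeight a b y
pairWeight-≢ {a = a} {b} a≢b x!≡y! with Finₚ.<-cmp a b
... | tri< _ _ _   = x!≡y!
... | tri≈ _ a≡b _ = contradiction a≡b a≢b
... | tri> _ _ _   = refl

pairWeight-positive : ∀ (a b : Fin n) x → 1 ≤ pairWeight a b x
pairWeight-positive a b x with Finₚ.<-cmp a b
... | tri< _ _ _ = 1≤n! x
... | tri≈ _ _ _ = *-mono-≤ (m^n>0 2 x) (1≤n! x)
... | tri> _ _ _ = ≤-refl

pairWeight-0 : ∀ (a b : Fin n) → pairWeight a b 0 ≡ 1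
pairWeight-0 a b with Finₚ.<-cmp a b
... | tri< _ _ _ = refl
... | tri≈ _ _ _ = refl
... | tri> _ _ _ = refl

weight : Tensor n T → ℕ
weight f = ∏ λ i → ∏ λ j → ∏ λ t → pairWeight i j (f i j t)

weight-cong : {f g : Tensor n T} → f ≐ g → weight f ≡ weight g
weight-cong {n} {T} f≐g =
  ∏-cong {n} λ i → ∏-cong {n} λ j → ∏-cong {T} λ t → cong (pairWeight i j) (f≐g i j t)

weight-positive : ∀ (f : Tensor n T) → 1 ≤ weight f
weight-positive f =
  ∏-positive _ λ i → ∏-positive _ λ j → ∏-positive _ λ t → pairWeight-positive i j (f i j t)

weight-zero : ∀ (f : Tensor n T) → (∀ i j t → f i j t ≡ 0) → weight f ≡ 1
weight-zero {n} {T} f f≡0 = trans (∏-cong {n} λ i → trans (∏-cong {n} (trivial i)) (∏-one n)) (∏-one n)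
  where
  trivial : ∀ i j → ∏ (λ t → pairWeight i j (f i j t)) ≡ 1
  trivial i j = trans (∏-cong {T} λ t → trans (cong (pairWeight i j) (f≡0 i j t)) (pairWeight-0 i j)) (∏-one T)

halfEdges : Edge n T → Tensor n T → ℕ
halfEdges (a , b , s) f = f a b s + δ a b * f a b s

halfEdges-zero : ∀ (f : Tensor n T) a b s → f a b s ≡ 0 → halfEdges (a , b , s) f ≡ 0
halfEdges-zero f a b s f≡0 rewrite f≡0 = *-zeroʳ (δ a b)

halfEdges-loop : ∀ (f : Tensor n T) a s → halfEdges (a , a , s) f ≡ 2 * f a a s
halfEdges-loop f a s = cong (λ k → f a a s + k * f a a s) (δ-refl a)

halfEdges-≢ : ∀ (f : Tensor n T) {a b} s → a ≢ b → halfEdges (a , b , s) f ≡ f a b s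
halfEdges-≢ f {a} {b} s a≢b = trans (cong (λ k → f a b s + k * f a b s) (δ-≢ a≢b)) (+-identityʳ (f a b s))

∑-halfEdges : ∀ (f : Tensor n T) a → ∑ (λ b → ∑ (λ t → halfEdges (a , b , t) f)) ≡ deg f a
∑-halfEdges {n} {T} f a = begin
  ∑ (λ b → ∑ (λ t → f a b t + δ a b * f a b t))
    ≡⟨ ∑-cong {n} (λ b → ∑-distrib-+ (f a b) (λ t → δ a b * f a b t)) ⟩
  ∑ (λ b → ∑ (f a b) + ∑ (λ t → δ a b * f a b t))
    ≡⟨ ∑-distrib-+ (λ b → ∑ (f a b)) (λ b → ∑ (λ t → δ a b * f a b t)) ⟩
  ∑ (λ b → ∑ (f a b)) + ∑ (λ b → ∑ (λ t → δ a b * f a b t))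
    ≡⟨ cong (∑ (λ b → ∑ (f a b)) +_) (∑-cong {n} λ b → *-distribˡ-sum (δ a b) (f a b)) ⟨
  ∑ (λ b → ∑ (f a b)) + ∑ (λ b → δ a b * ∑ (f a b))
    ≡⟨ cong (∑ (λ b → ∑ (f a b)) +_) (∑-supported _ a λ b b≢a → cong (_* ∑ (f a b)) (δ-≢ (b≢a ∘ sym))) ⟩
  ∑ (λ b → ∑ (f a b)) + δ a a * ∑ (f a a)
    ≡⟨ cong (λ k → ∑ (λ b → ∑ (f a b)) + k * ∑ (f a a)) (δ-refl a) ⟩
  ∑ (λ b → ∑ (f a b)) + 1 * ∑ (f a a)
    ≡⟨ cong (∑ (λ b → ∑ (f a b)) +_) (*-identityˡ (∑ (f a a))) ⟩
  deg f a
    ∎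
  where open ≡-Reasoning

2^x*x!-∸1 : ∀ x → 1 ≤ x → 2 ^ x * x ! ≡ 2 ^ (x ∸ 1) * (x ∸ 1) ! * (2 * x)
2^x*x!-∸1 (suc x) _ = shuffle (2 ^ x) (x !) (suc x)
  where
  open +-*-Solver
  shuffle : ∀ p q r → 2 * p * (r * q) ≡ p * q * (2 * r)
  shuffle = solve 3 (λ p q r → (con 2 :* p) :* (r :* q) := (p :* q) :* (con 2 :* r)) refl

weight-⊖-oriented : ∀ (f : Tensor n T) a b s → ¬ b Fin.< a → 1 ≤ f a b s →
  weight f ≡ weight (f ⊖ (a , b , s)) * halfEdges (a , b , s) f
weight-⊖-oriented f a b s b≮a 1≤f =
  ∏³-update _ _ a b s (halfEdges (a , b , s) f) unchanged
    (trans (at-edge (a Finₚ.≟ b)) (cong (λ y → pairWeight a b (f a b s ∸ y) * halfEdges (a , b , s) f)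
                                         (sym (edge-at a b s))))
  where
  unchanged : ∀ i j t → (i , j , t) ≢ (a , b , s) →
              pairWeight i j (f i j t) ≡ pairWeight i j ((f ⊖ (a , b , s)) i j t)
  unchanged i j t ≢e with edge-⊎ (a , b , s) i j t
  ... | inj₁ e≡0 = cong (λ y → pairWeight i j (f i j t ∸ y)) (sym e≡0)
  ... | inj₂ (refl , inj₁ (refl , refl)) = contradiction refl ≢e
  ... | inj₂ (refl , inj₂ (refl , refl)) with Finₚ.<-cmp a b
  ...   | tri< a<b _ _  = trans (pairWeight-> _ a<b) (sym (pairWeight-> _ a<b))
  ...   | tri≈ _ refl _ = contradiction refl ≢e
  ...   | tri> _ _ b<a  = contradiction b<a b≮a
  at-edge : Dec (a ≡ b) →
            pairWeight a b (f a b s) ≡ pairWeight a b (f a b s ∸ 1) * halfEdges (a , b , s) f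
  at-edge (yes refl) = begin
    pairWeight a a (f a a s)
      ≡⟨ pairWeight-≡ a (f a a s) ⟩
    2 ^ f a a s * f a a s !
      ≡⟨ 2^x*x!-∸1 (f a a s) 1≤f ⟩
    2 ^ (f a a s ∸ 1) * (f a a s ∸ 1) ! * (2 * f a a s)
      ≡⟨ cong₂ _*_ (pairWeight-≡ a (f a a s ∸ 1)) (halfEdges-loop f a s) ⟨
    pairWeight a a (f a a s ∸ 1) * halfEdges (a , a , s) f
      ∎
    where open ≡-Reasoning
  at-edge (no a≢b) = begin
    pairWeight a b (f a b s)
      ≡⟨ pairWeight-< (f a b s) a<b ⟩
    f a b s !
      ≡⟨ !-∸1 (f a b s) 1≤f ⟩
    (f a b s ∸ 1) ! * f a b s
      ≡⟨ cong₂ _*_ (pairWeight-< (f a b s ∸ 1) a<b) (halfEdges-≢ f s a≢b) ⟨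
    pairWeight a b (f a b s ∸ 1) * halfEdges (a , b , s) f
      ∎
    where
    open ≡-Reasoning
    a<b : a Fin.< b
    a<b = Finₚ.≤∧≢⇒< (≮⇒≥ b≮a) a≢b

weight-⊖ : ∀ (f : Tensor n T) → Symmetric f → ∀ a b s → 1 ≤ f a b s →
  weight f ≡ weight (f ⊖ (a , b , s)) * halfEdges (a , b , s) f
weight-⊖ f f-sym a b s 1≤f with b Finₚ.<? a
... | no b≮a = weight-⊖-oriented f a b s b≮a 1≤f
... | yes b<a = begin
  weight f
    ≡⟨ weight-⊖-oriented f b a s (Finₚ.<-asym b<a) (subst (1 ≤_) (f-sym a b s) 1≤f) ⟩
  weight (f ⊖ (b , a , s)) * halfEdges (b , a , s) f
    ≡⟨ cong₂ _*_ (weight-cong λ i j t → cong (f i j t ∸_) (edge-flip b a s i j t)) flipped ⟩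
  weight (f ⊖ (a , b , s)) * halfEdges (a , b , s) f
    ∎
  where
  open ≡-Reasoning
  flipped : halfEdges (b , a , s) f ≡ halfEdges (a , b , s) f
  flipped = trans (halfEdges-≢ f s (Finₚ.<⇒≢ b<a))
                  (trans (f-sym b a s) (sym (halfEdges-≢ f s (Finₚ.<⇒≢ b<a ∘ sym))))

𝐖-loop : ∀ (G : TGraph n T) i t → 𝐖 G i i t ≡ w G i i t
𝐖-loop G i t rewrite dec-true (i Finₚ.≟ i) refl = refl

𝐖-≢ : ∀ (G : TGraph n T) {i j} t → i ≢ j → 𝐖 G i j t ≡ (if does (2 ≤? w G i j t) then w G i j t else 0)
𝐖-≢ G {i} {j} t i≢j rewrite dec-false (i Finₚ.≟ j) i≢j = refl

-- 𝐖 truncates multiplicities below 2 to 0, which 0 ! = 1 ! = 1 cannot detect.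
!-truncation : ∀ x y → (if does (2 ≤? x) then x else 0) ≡ (if does (2 ≤? y) then y else 0) → x ! ≡ y !
!-truncation 0             0             _ = refl
!-truncation 0             1             _ = refl
!-truncation 1             0             _ = refl
!-truncation 1             1             _ = refl
!-truncation (suc (suc x)) (suc (suc y)) e = cong _! e
!-truncation 0             (suc (suc y)) ()
!-truncation 1             (suc (suc y)) ()
!-truncation (suc (suc x)) 0             ()
!-truncation (suc (suc x)) 1             ()

weight-𝐖 : ∀ (G₁ G₂ : TGraph n T) → (∀ i j t → 𝐖 G₁ i j t ≡ 𝐖 G₂ i j t) → weight (w G₁) ≡ weight (w G₂)
weight-𝐖 {n} {T} G₁ G₂ 𝐖≡ = ∏-cong {n} λ i → ∏-cong {n} λ j → ∏-cong {T} λ t → pointwise i j t (i Finₚ.≟ j)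
  where
  pointwise : ∀ i j t → Dec (i ≡ j) → pairWeight i j (w G₁ i j t) ≡ pairWeight i j (w G₂ i j t)
  pointwise i _ t (yes refl) =
    cong (pairWeight i i) (trans (sym (𝐖-loop G₁ i t)) (trans (𝐖≡ i i t) (𝐖-loop G₂ i t)))
  pointwise i j t (no i≢j) = pairWeight-≢ i≢j (!-truncation (w G₁ i j t) (w G₂ i j t)
    (trans (sym (𝐖-≢ G₁ t i≢j)) (trans (𝐖≡ i j t) (𝐖-≢ G₂ t i≢j))))

-- The number of runs

infix 10 _‼

_‼ : ℕ → ℕ
zero        ‼ = 1
suc zero    ‼ = 1
suc (suc m) ‼ = suc (suc m) * m ‼

no-edges-at-exhausted : ∀ (f : Tensor n T) (c : Fin n → ℕ) → Symmetric f → (∀ i → deg f i ≡ c i) →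
  ∀ a b → c b ∸ δ a b ≡ 0 → ∀ t → f a b t ≡ 0
no-edges-at-exhausted f c f-sym deg≡ a b exhausted t with a Finₚ.≟ b
... | yes refl = twice≤1 (≤-trans (loops-≤-deg f a t) (subst (_≤ 1) (sym (deg≡ a)) (m∸n≡0⇒m≤n exhausted)))
  where
  twice≤1 : ∀ {x} → x + x ≤ 1 → x ≡ 0
  twice≤1 {zero}  _ = refl
  twice≤1 {suc x} (s≤s x+1+x≤0) with () ← subst (_≤ 0) (+-suc x x) x+1+x≤0
... | no _ = trans (f-sym a b t) (n≤0⇒n≡0 (subst (f b a t ≤_) (trans (deg≡ b) exhausted) (≤-deg f b a t)))

RunsWeightInvariant : ∀ n T .{{_ : NonZero T}} → ℕ → Set
RunsWeightInvariant n T m =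
  ∀ (u : Vec (Fin n) m) (f : Tensor n T) → Symmetric f → (∀ i → deg f i ≡ count u i) →
  #runs m u f * weight f ≡ m ‼ * factorials u

runsWeight-zero : .{{_ : NonZero T}} → RunsWeightInvariant n T 0
runsWeight-zero {n = n} [] f f-sym deg≡ = begin
  (𝟙 (does (w [] ≐? f)) + 0) * weight f
    ≡⟨ cong₂ (λ b x → (𝟙 b + 0) * x) (dec-true (w [] ≐? f) (λ i j t → sym (no-edges i j t))) (weight-zero f no-edges) ⟩
  1
    ≡⟨ trans (*-identityˡ _) (∏-one n) ⟨
  0 ‼ * factorials {n} []
    ∎
  where
  open ≡-Reasoning
  no-edges : ∀ i j t → f i j t ≡ 0
  no-edges i j t = n≤0⇒n≡0 (subst (f i j t ≤_) (deg≡ i) (≤-deg f i j t))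

#runsAfterDraw-weight : ∀ {n m T} .{{_ : NonZero T}} → RunsWeightInvariant n T m →
  ∀ (u : Vec (Fin n) (2 + m)) f → Symmetric f → (∀ i → deg f i ≡ count u i) → ∀ p q t →
  #runsAfterDraw m u f p q t * weight f ≡ m ‼ * factorials (leftover u p q) * halfEdges (drawnEdge u p q t) f
#runsAfterDraw-weight {n} {m} {T} IH u f f-sym deg≡ p q t = by-cases (edge e ≤ᵗ? f)
  where
  a b : Fin n
  a = lookup u p
  b = lookup (removeAt u p) q
  e : Edge n T
  e = drawnEdge u p q t
  by-cases : (e≤f? : Dec (edge e ≤ᵗ f)) →
    (if does e≤f? then #runs m (leftover u p q) (f ⊖ e) else 0) * weight f
      ≡ m ‼ * factorials (leftover u p q) * halfEdges e f
  by-cases (yes e≤f) = begin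
    #runs m (leftover u p q) (f ⊖ e) * weight f
      ≡⟨ cong (#runs m (leftover u p q) (f ⊖ e) *_) (weight-⊖ f f-sym a b t 1≤f) ⟩
    #runs m (leftover u p q) (f ⊖ e) * (weight (f ⊖ e) * halfEdges e f)
      ≡⟨ *-assoc (#runs m (leftover u p q) (f ⊖ e)) (weight (f ⊖ e)) (halfEdges e f) ⟨
    #runs m (leftover u p q) (f ⊖ e) * weight (f ⊖ e) * halfEdges e f
      ≡⟨ cong (_* halfEdges e f) (IH (leftover u p q) (f ⊖ e) (⊖-symmetric f-sym e) deg-⊖≡count) ⟩
    m ‼ * factorials (leftover u p q) * halfEdges e f
      ∎
    where
    open ≡-Reasoning
    1≤f : 1 ≤ f a b t
    1≤f = subst (_≤ f a b t) (edge-at a b t) (e≤f a b t)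
    deg-⊖≡count : ∀ i → deg (f ⊖ e) i ≡ count (leftover u p q) i
    deg-⊖≡count i = trans (deg-⊖ f e e≤f i)
                          (trans (cong (_∸ endpoints i e) (deg≡ i)) (sym (count-leftover u p q t i)))
  by-cases (no e≰f) = sym (trans
    (cong (m ‼ * factorials (leftover u p q) *_)
          (halfEdges-zero f a b t (n≤0⇒n≡0 (≮⇒≥ (e≰f ∘ edge-≤ᵗ f f-sym a b t)))))
    (*-zeroʳ (m ‼ * factorials (leftover u p q))))

∑-#runsAfterDraw-weight : ∀ {n m T} .{{_ : NonZero T}} → RunsWeightInvariant n T m →
  ∀ (u : Vec (Fin n) (2 + m)) f → Symmetric f → (∀ i → deg f i ≡ count u i) → ∀ p →
  (∑ λ q → ∑ λ t → #runsAfterDraw m u f p q t) * weight f ≡ m ‼ * factorials u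
∑-#runsAfterDraw-weight {n} {m} {T} IH u f f-sym deg≡ p = begin
  (∑ λ q → ∑ λ t → #runsAfterDraw m u f p q t) * weight f
    ≡⟨ *-distribʳ-sum (weight f) (λ q → ∑ λ t → #runsAfterDraw m u f p q t) ⟩
  ∑ (λ q → (∑ λ t → #runsAfterDraw m u f p q t) * weight f)
    ≡⟨ ∑-cong {1 + m} (λ q → trans (*-distribʳ-sum (weight f) (#runsAfterDraw m u f p q))
                                   (∑-cong {T} (#runsAfterDraw-weight IH u f f-sym deg≡ p q))) ⟩
  ∑ (λ q → ∑ λ t → m ‼ * factorials (removeAt u′ q) * halfEdges (a , lookup u′ q , t) f)
    ≡⟨ ∑-cong {1 + m} (λ q → trans (sym (*-distribˡ-sum (m ‼ * factorials (removeAt u′ q)) (ρ-at (lookup u′ q))))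
                                   (*-assoc (m ‼) _ _)) ⟩
  ∑ (λ q → m ‼ * (factorials (removeAt u′ q) * ρ (lookup u′ q)))
    ≡⟨ *-distribˡ-sum (m ‼) (λ q → factorials (removeAt u′ q) * ρ (lookup u′ q)) ⟨
  m ‼ * ∑ (λ q → factorials (removeAt u′ q) * ρ (lookup u′ q))
    ≡⟨ cong (m ‼ *_) (∑-removeAt-factorials u′ ρ ρ-vanishes) ⟩
  m ‼ * (factorials u′ * ∑ ρ)
    ≡⟨ cong (λ x → m ‼ * (factorials u′ * x)) (trans (∑-halfEdges f a) (deg≡ a)) ⟩
  m ‼ * (factorials u′ * count u a)
    ≡⟨ cong (m ‼ *_) (factorials-removeAt u p) ⟩
  m ‼ * factorials u
    ∎
  where
  open ≡-Reasoning
  a : Fin n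
  a = lookup u p
  u′ : Vec (Fin n) (1 + m)
  u′ = removeAt u p
  ρ-at : Fin n → Fin T → ℕ
  ρ-at b t = halfEdges (a , b , t) f
  ρ : Fin n → ℕ
  ρ b = ∑ (ρ-at b)
  ρ-vanishes : ∀ b → count u′ b ≡ 0 → ρ b ≡ 0
  ρ-vanishes b exhausted = trans (∑-cong {T} λ t → halfEdges-zero f a b t
      (no-edges-at-exhausted f (count u) f-sym deg≡ a b (trans (sym (count-removeAt u p b)) exhausted) t))
    (∑-zero T)

runsWeight-step : ∀ {n m T} .{{_ : NonZero T}} → RunsWeightInvariant n T m → RunsWeightInvariant n T (2 + m)
runsWeight-step {n} {m} {T} IH u f f-sym deg≡ = begin
  #runs (2 + m) u f * weight f
    ≡⟨ cong (_* weight f) (#runs-step {n} {T} m u f) ⟩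
  (∑ λ p → ∑ λ q → ∑ λ t → #runsAfterDraw m u f p q t) * weight f
    ≡⟨ *-distribʳ-sum (weight f) (λ p → ∑ λ q → ∑ λ t → #runsAfterDraw m u f p q t) ⟩
  ∑ (λ p → (∑ λ q → ∑ λ t → #runsAfterDraw m u f p q t) * weight f)
    ≡⟨ ∑-cong {2 + m} (∑-#runsAfterDraw-weight IH u f f-sym deg≡) ⟩
  ∑ {2 + m} (λ _ → m ‼ * factorials u)
    ≡⟨ ∑-const (2 + m) (m ‼ * factorials u) ⟩
  (2 + m) * (m ‼ * factorials u)
    ≡⟨ *-assoc (2 + m) (m ‼) (factorials u) ⟨
  (2 + m) ‼ * factorials u
    ∎
  where open ≡-Reasoning

runsWeight : .{{_ : NonZero T}} → ∀ k → RunsWeightInvariant n T (k * 2)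
runsWeight zero    = runsWeight-zero
runsWeight (suc k) = runsWeight-step (runsWeight k)

#runs-𝐖 : .{{_ : NonZero T}} → ∀ (d : Fin n → ℕ) k {m} → m ≡ k * 2 → (u : Vec (Fin n) m) →
  (∀ i → count u i ≡ d i) → (G₁ G₂ : TGraph n T) → Matches d G₁ → Matches d G₂ →
  (∀ i j t → 𝐖 G₁ i j t ≡ 𝐖 G₂ i j t) → #runs m u (w G₁) ≡ #runs m u (w G₂)
#runs-𝐖 d k refl u count≡d G₁ G₂ G₁∈ G₂∈ 𝐖≡ =
  *-cancelʳ-≡ (#runs _ u (w G₁)) (#runs _ u (w G₂)) (weight (w G₁)) {{>-nonZero (weight-positive (w G₁))}}
    (begin
      #runs _ u (w G₁) * weight (w G₁)   ≡⟨ runsWeight k u (w G₁) (w-symmetric G₁) (balanced G₁ G₁∈) ⟩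
      (k * 2) ‼ * factorials u           ≡⟨ runsWeight k u (w G₂) (w-symmetric G₂) (balanced G₂ G₂∈) ⟨
      #runs _ u (w G₂) * weight (w G₂)   ≡⟨ cong (#runs _ u (w G₂) *_) (weight-𝐖 G₁ G₂ 𝐖≡) ⟨
      #runs _ u (w G₂) * weight (w G₁)   ∎)
  where
  open ≡-Reasoning
  balanced : ∀ G → Matches d G → ∀ i → deg (w G) i ≡ count u i
  balanced G G∈ i = trans (deg-w G i) (trans (G∈ i) (sym (count≡d i)))

theorem3 : (n : ℕ) (d : Fin n → ℕ) (T : ℕ) .{{_ : NonZero T}} →
    total d % 2 ≡ 0 →
    (G₁ G₂ : TGraph n T) → Matches d G₁ → Matches d G₂ →
    (∀ i j t → 𝐖 G₁ i j t ≡ 𝐖 G₂ i j t) →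
    Pr d T G₁ ≡ Pr d T G₂
theorem3 n d T even G₁ G₂ G₁∈ G₂∈ 𝐖≡ = begin
  Pr d T G₁               ≡⟨ Pr≡#runs×pathProbability d T G₁ ⟩
  #runs M u (w G₁) ×ℚ P   ≡⟨ cong (_×ℚ P) #runs≡ ⟩
  #runs M u (w G₂) ×ℚ P   ≡⟨ Pr≡#runs×pathProbability d T G₂ ⟨
  Pr d T G₂               ∎
  where
  open ≡-Reasoning
  M : ℕ
  M = List.length (urn d)
  u : Vec (Fin n) M
  u = fromList (urn d)
  P : ℚ
  P = pathProbability T M
  M-even : M ≡ total d ℕ./ 2 * 2
  M-even = trans (length-urn d) (trans (m≡m%n+[m/n]*n (total d) 2) (cong (_+ total d ℕ./ 2 * 2) even))
  #runs≡ : #runs M u (w G₁) ≡ #runs M u (w G₂)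
  #runs≡ = #runs-𝐖 d (total d ℕ./ 2) M-even u (count-urn d) G₁ G₂ G₁∈ G₂∈ 𝐖≡
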